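{- Let $\varphi$ be a primitive holomorphic cusp form of weight $k$ and $r\ge1$. The set of critical integers for $L_f(s,\mathrm{Sym}^{2r}\varphi)$ is: (1) if $r$ odd, $k$ even: $\{(r-1)(k-1)+1,(r-1)(k-1)+3,\dots,r(k-1)\}\cup\{r(k-1)+1,r(k-1)+3,\dots,(r+1)(k-1)\}$; (2) if $r$ odd, $k$ odd: $\{(r-1)(k-1)+1,(r-1)(k-1)+3,\dots,r(k-1)-1\}\cup\{r(k-1)+2,r(k-1)+4,\dots,(r+1)(k-1)\}$; (3) if $r$ even, $k$ even: $\{(r-1)(k-1)+2,(r-1)(k-1)+4,\dots,r(k-1)-1\}\cup\{r(k-1)+2,r(k-1)+4,\dots,(r+1)(k-1)-1\}$; (4) if $r$ even, $k$ odd: $\{(r-1)(k-1)+1,(r-1)(k-1)+3,\dots,r(k-1)-1\}\cup\{r(k-1)+2,r(k-1)+4,\dots,(r+1)(k-1)\}$.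
   Context: $L_f(s,\mathrm{Sym}^n\varphi)$ is the symmetric power $L$-function in the classical normalization (local factors $\prod_{i=0}^n(1-\alpha_p^i\beta_p^{n-i}p^{ -s})^{ -1}$ at good primes), so $L_f(s,\mathrm{Sym}^n\varphi)=L_f(s-n(k-1)/2,\mathrm{Sym}^n\pi(\varphi))$. The archimedean parameter of $\pi(\varphi)$ is $I(\chi_{k-1})=\mathrm{Ind}_{\mathbb C^\times}^{W_{\mathbb R}}(\chi_{k-1})$, $\chi_{k-1}(z)=(z/|z|)^{k-1}$. Archimedean factors: $L(s,|\cdot|^t)=\pi^{ -(s+t)/2}\Gamma(\frac{s+t}2)$, $L(s,\epsilon\otimes|\cdot|^t)=\pi^{ -(s+t+1)/2}\Gamma(\frac{s+t+1}2)$ ($\epsilon$ sign character of $W_{\mathbb R}$), $L(s,I(\chi_l)\otimes|\cdot|^t)=2(2\pi)^{ -(s+t+l/2)}\Gamma(s+t+l/2)$ for $l\ge1$, multiplicative in direct sums. An integer $m$ is critical for $L_f(s,\mathrm{Sym}^n\varphi)$ if, with $\rho=\mathrm{Sym}^n(I(\chi_{k-1}))$ (self-dual), both $L(s,\rho)$ and $L(1-s,\rho)$ are regular at $s=m-n(k-1)/2$. Lists "$a,a+2,\dots,b$" denote arithmetic progressions with step $2$. -}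

module Defs where

open import Data.Nat using (ℕ; zero; suc)
import Data.Nat as ℕ
open import Data.Integer using (ℤ; +_; _+_; _-_; _*_; -_; _≤_; 1ℤ)
open import Data.List using (List; []; _∷_; _++_; map; upTo)
open import Data.List.Relation.Unary.All using (All)
open import Data.Product using (_×_; ∃-syntax)
open import Relation.Binary.PropositionalEquality using (_≡_)
open import Relation.Nullary using (¬_)

-- Irreducible (t = 0) representations of the Weil group W_R that occur:
--   triv  = trivial character |.|^0
--   sgn   = sign character ε
--   ind l = I(χ_l) = Ind_{C^×}^{W_R} χ_l , χ_l(z) = (z/|z|)^l
-- A (semisimple) Langlands parameter is a list of such constituents (direct sum).
data Const : Set where
  triv : Const
  sgn  : Const
  ind  : ℕ → Const

Param : Set
Param = List Const

sgnPow : ℕ → Const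
sgnPow zero = triv
sgnPow (suc zero) = sgn
sgnPow (suc (suc n)) = sgnPow n

-- Sym^(2r) (I(χ_l)) decomposed into irreducibles:
--   ⊕_{i=0}^{r-1} I(χ_{l(2r-2i)})  ⊕  ε^{l r}
-- (C^× acts on e_0^{2r-i} e_1^i by χ_{l(2r-2i)}, j swaps the weights ±, and on the
--  middle vector e_0^r e_1^r j acts by ((-1)^l)^r.)
symEven : ℕ → ℕ → Param
symEven r l = map (λ i → ind (2 ℕ.* l ℕ.* (r ℕ.∸ i))) (upTo r) ++ (sgnPow (l ℕ.* r) ∷ [])

-- ΓHalfPole y : the Gamma function Γ(y/2) has a pole, i.e. y/2 ∈ {0,-1,-2,...}.
ΓHalfPole : ℤ → Set
ΓHalfPole y = ∃[ j ] y ≡ - (+ (2 ℕ.* j))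

-- Pole of the archimedean L-factor of a constituent at an integer point s
-- (the remaining factors π^(..), 2(2π)^(..) are entire and nonvanishing, Γ has no zeros):
--   L(s,1)      = π^{-s/2} Γ(s/2)            : argument of Γ is s/2
--   L(s,ε)      = π^{-(s+1)/2} Γ((s+1)/2)    : argument (s+1)/2
--   L(s,I(χ_l)) = 2(2π)^{-(s+l/2)} Γ(s+l/2)   : argument (2s+l)/2
poleAt : Const → ℤ → Set
poleAt triv s = ΓHalfPole s
poleAt sgn s = ΓHalfPole (s + 1ℤ)
poleAt (ind l) s = ΓHalfPole (s + s + + l)

-- L(s,ρ) is regular at s (multiplicative in direct sums).
Regular : Param → ℤ → Set
Regular ρ s = All (λ c → ¬ poleAt c s) ρ

-- m is critical for L_f(s, Sym^{2r} φ), φ of weight k: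
-- with ρ = Sym^{2r}(I(χ_{k-1})), L(s,ρ) and L(1-s,ρ) regular at s = m - 2r(k-1)/2.
CriticalSym2r : ℕ → ℕ → ℤ → Set
CriticalSym2r r k m =
  Regular (symEven r (k ℕ.∸ 1)) s × Regular (symEven r (k ℕ.∸ 1)) (1ℤ - s)
  where
  s : ℤ
  s = m - + (r ℕ.* (k ℕ.∸ 1))

InAP : ℤ → ℤ → ℤ → Set
InAP a b m = (a ≤ m) × (m ≤ b) × ∃[ j ] m ≡ a + + (2 ℕ.* j)

{-# OPTIONS --safe #-}
-- Put l = k − 1 and write m = (r − 1)l + d, so that the point of the criticality condition is
-- s = m − rl = d − l.  The parameter Sym^{2r} I(χ_l) is the sum of the induced parameters
-- I(χ_{2lc}), 1 ≤ c ≤ r, and the character ε^{lr}.  The factors Γ(s + lc) are regular at s and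
-- at 1 − s exactly when 1 ≤ d ≤ 2l, so nothing below (r − 1)l + 1 is critical.  Inside this window
-- only the factor of ε^{lr} can have a pole, Γ(s/2) or Γ((s + 1)/2), and Γ(x/2) has a pole at an
-- integer x iff x ≤ 0 is even; so on each side of the centre every second offset d is excluded,
-- and which ones is decided by the parities of l and lr.
module Submission where

open import Defs

module EvenGaps where
  open import Data.Nat
  open import Data.Nat.Properties
  open import Data.Nat.Divisibility using (_∣_; divides)
  open import Data.Nat.Tactic.RingSolver using (solve-∀)
  open import Data.Parity.Base as ℙ using (Parity; 0ℙ; 1ℙ; _⁻¹)
  import Data.Parity.Properties as ℙₚ
  open import Data.Empty using (⊥-elim)
  open import Data.Product using (_×_; _,_; ∃-syntax)
  open import Data.Sum using (_⊎_; inj₁; inj₂)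
  open import Function.Bundles using (_⇔_; mk⇔)
  open import Relation.Nullary using (¬_; contradiction)
  open import Relation.Binary.PropositionalEquality

  parity-suc : ∀ n → parity (suc n) ≡ parity n ⁻¹
  parity-suc n = sym (ℙₚ.⁻¹-selfInverse (ℙₚ.suc-homo-⁻¹ n))

  parity-suc≡ : ∀ n {p} → parity n ≡ p → parity (suc n) ≡ p ⁻¹
  parity-suc≡ n pn≡p = trans (parity-suc n) (cong _⁻¹ pn≡p)

  parity-pred≡ : ∀ n {p} → parity (suc n) ≡ p → parity n ≡ p ⁻¹
  parity-pred≡ n psn≡p = trans (sym (ℙₚ.suc-homo-⁻¹ n)) (cong _⁻¹ psn≡p)

  parities-differ : ∀ {x y p : Parity} → x ≡ p → y ≡ p ⁻¹ → x ≢ y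
  parities-differ {p = p} x≡p y≡p⁻¹ x≡y = ℙₚ.p≢p⁻¹ p (trans (sym x≡p) (trans x≡y y≡p⁻¹))

  parity-double : ∀ n → parity (n + n) ≡ 0ℙ
  parity-double n = trans (ℙₚ.+-homo-+ n n) (ℙₚ.p+p≡0ℙ (parity n))

  parity≡0ℙ⇒even : ∀ n → parity n ≡ 0ℙ → ∃[ j ] n ≡ 2 * j
  parity≡0ℙ⇒even zero _ = 0 , refl
  parity≡0ℙ⇒even (suc zero) ()
  parity≡0ℙ⇒even (suc (suc n)) p with parity≡0ℙ⇒even n p
  ... | j , refl = suc j , cong suc (sym (+-suc j (j + 0)))

  ∣⇒parity≡0ℙ : ∀ {n} → 2 ∣ n → parity n ≡ 0ℙ
  ∣⇒parity≡0ℙ (divides q refl) = trans (ℙₚ.*-homo-* q 2) (ℙₚ.*-zeroʳ (parity q))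

  ∤⇒parity≡1ℙ : ∀ {n} → ¬ 2 ∣ n → parity n ≡ 1ℙ
  ∤⇒parity≡1ℙ {n} 2∤n with parity n in pn
  ... | 1ℙ = refl
  ... | 0ℙ = let j , n≡2j = parity≡0ℙ⇒even n pn
             in contradiction (divides j (trans n≡2j (*-comm 2 j))) 2∤n

  m+n≰n⇔0<m : ∀ m n → (¬ m + n ≤ n) ⇔ 0 < m
  m+n≰n⇔0<m zero n = mk⇔ (λ n≰n → ⊥-elim (n≰n ≤-refl)) (λ ())
  m+n≰n⇔0<m (suc m) n = mk⇔ (λ _ → s≤s z≤n) (λ 0<m → <⇒≱ (m<n+m n 0<m))

  data EvenGap (a b : ℕ) : Set where
    evenGap : ∀ j → b ≡ a + 2 * j → EvenGap a b

  evenGap⇒≤ : ∀ {a b} → EvenGap a b → a ≤ b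
  evenGap⇒≤ {a} (evenGap j refl) = m≤m+n a (2 * j)

  evenGap⇒parity : ∀ {a b} → EvenGap a b → parity a ≡ parity b
  evenGap⇒parity {a} (evenGap j refl) = sym (begin
    parity (a + 2 * j)           ≡⟨ ℙₚ.+-homo-+ a (2 * j) ⟩
    parity a ℙ.+ parity (2 * j)  ≡⟨ cong (parity a ℙ.+_) (ℙₚ.*-homo-* 2 j) ⟩
    parity a ℙ.+ 0ℙ              ≡⟨ ℙₚ.+-identityʳ (parity a) ⟩
    parity a                     ∎)
    where open ≡-Reasoning

  evenGap-intro : ∀ {a b} → a ≤ b → parity a ≡ parity b → EvenGap a b
  evenGap-intro {a} {b} a≤b pa≡pb =
    let j , gap≡2j = parity≡0ℙ⇒even (b ∸ a) gap-even
    in evenGap j (trans (sym (m+[n∸m]≡n a≤b)) (cong (a +_) gap≡2j))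
    where
    open ≡-Reasoning
    gap-even : parity (b ∸ a) ≡ 0ℙ
    gap-even = ℙₚ.+-cancelˡ-≡ (parity a) _ _ (begin
      parity a ℙ.+ parity (b ∸ a)  ≡⟨ ℙₚ.+-homo-+ a (b ∸ a) ⟨
      parity (a + (b ∸ a))         ≡⟨ cong parity (m+[n∸m]≡n a≤b) ⟩
      parity b                     ≡⟨ pa≡pb ⟨
      parity a                     ≡⟨ ℙₚ.+-identityʳ (parity a) ⟨
      parity a ℙ.+ 0ℙ              ∎)

  ¬evenGap⇒> : ∀ {a b} → ¬ EvenGap a b → parity a ≡ parity b → b < a
  ¬evenGap⇒> ¬gap pa≡pb = ≰⇒> (λ a≤b → ¬gap (evenGap-intro a≤b pa≡pb))

  ≤∧parity≢⇒< : ∀ {a b} → a ≤ b → parity a ≢ parity b → a < b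
  ≤∧parity≢⇒< a≤b pa≢pb = ≤∧≢⇒< a≤b (λ a≡b → pa≢pb (cong parity a≡b))

  <⇒¬evenGap : ∀ {a b} → b < a → ¬ EvenGap a b
  <⇒¬evenGap b<a gap = <⇒≱ b<a (evenGap⇒≤ gap)

  parity≢⇒¬evenGap : ∀ {a b} → parity a ≢ parity b → ¬ EvenGap a b
  parity≢⇒¬evenGap pa≢pb gap = pa≢pb (evenGap⇒parity gap)

  evenGap-double⇔ : ∀ a b → EvenGap (a + a) (b + b) ⇔ a ≤ b
  evenGap-double⇔ a b = mk⇔ to from
    where
    to : EvenGap (a + a) (b + b) → a ≤ b
    to gap = ≮⇒≥ (λ b<a → <⇒≱ (+-mono-< b<a b<a) (evenGap⇒≤ gap))
    from : a ≤ b → EvenGap (a + a) (b + b)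
    from a≤b with m≤n⇒∃[o]m+o≡n a≤b
    ... | t , refl = evenGap t (double-shift a t)
      where
      double-shift : ∀ x t → (x + t) + (x + t) ≡ (x + x) + 2 * t
      double-shift = solve-∀

  -- An offset d stands for the point s = d − l, and 1 − s = l + 1 − d; Γ(x/2) has a pole at
  -- x = a − b iff EvenGap a b.
  InWindow : ℕ → ℕ → Set
  InWindow l d = 1 ≤ d × d ≤ l + l

  TrivRegular : ℕ → ℕ → Set
  TrivRegular l d = ¬ EvenGap d l × ¬ EvenGap (suc l) d

  SgnRegular : ℕ → ℕ → Set
  SgnRegular l d = ¬ EvenGap (suc d) l × ¬ EvenGap (2 + l) d

  window-triv-even⇔ : ∀ {l d} → parity l ≡ 0ℙ →
    (InWindow l d × TrivRegular l d) ⇔ ((EvenGap 1 d × d < l) ⊎ (EvenGap (2 + l) d × d ≤ l + l))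
  window-triv-even⇔ {l} {d} pl = mk⇔ to from
    where
    psl : parity (suc l) ≡ 1ℙ
    psl = parity-suc≡ l pl
    to : InWindow l d × TrivRegular l d → (EvenGap 1 d × d < l) ⊎ (EvenGap (2 + l) d × d ≤ l + l)
    to ((1≤d , d≤2l) , ¬gap-d-l , ¬gap-sl-d) with parity d in pd
    ... | 1ℙ = inj₁ (evenGap-intro 1≤d (sym pd) , ≤∧parity≢⇒< d≤l (parities-differ pd pl))
      where
      d≤l : d ≤ l
      d≤l = s≤s⁻¹ (¬evenGap⇒> ¬gap-sl-d (trans psl (sym pd)))
    ... | 0ℙ = inj₂ (evenGap-intro 2+l≤d (trans pl (sym pd)) , d≤2l)
      where
      2+l≤d : 2 + l ≤ d
      2+l≤d = ≤∧parity≢⇒< (¬evenGap⇒> ¬gap-d-l (trans pd (sym pl))) (parities-differ psl pd)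
    from : (EvenGap 1 d × d < l) ⊎ (EvenGap (2 + l) d × d ≤ l + l) → InWindow l d × TrivRegular l d
    from (inj₁ (gap , d<l)) =
      (evenGap⇒≤ gap , ≤-trans (<⇒≤ d<l) (m≤m+n l l)) ,
      parity≢⇒¬evenGap (parities-differ (sym (evenGap⇒parity gap)) pl) ,
      <⇒¬evenGap (m≤n⇒m≤1+n d<l)
    from (inj₂ (gap , d≤2l)) =
      (≤-trans (s≤s z≤n) (evenGap⇒≤ gap) , d≤2l) ,
      <⇒¬evenGap (<⇒≤ (evenGap⇒≤ gap)) ,
      parity≢⇒¬evenGap (parities-differ psl (trans (sym (evenGap⇒parity gap)) pl))

  window-triv-odd⇔ : ∀ {l d} → parity l ≡ 1ℙ →
    (InWindow l d × TrivRegular l d) ⇔ ((EvenGap 2 d × d < l) ⊎ (EvenGap (2 + l) d × d < l + l))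
  window-triv-odd⇔ {l} {d} pl = mk⇔ to from
    where
    psl : parity (suc l) ≡ 0ℙ
    psl = parity-suc≡ l pl
    to : InWindow l d × TrivRegular l d → (EvenGap 2 d × d < l) ⊎ (EvenGap (2 + l) d × d < l + l)
    to ((1≤d , d≤2l) , ¬gap-d-l , ¬gap-sl-d) with parity d in pd
    ... | 0ℙ = inj₁ (evenGap-intro 2≤d (sym pd) , ≤∧parity≢⇒< d≤l (parities-differ pd pl))
      where
      2≤d : 2 ≤ d
      2≤d = ≤∧parity≢⇒< 1≤d (parities-differ refl pd)
      d≤l : d ≤ l
      d≤l = s≤s⁻¹ (¬evenGap⇒> ¬gap-sl-d (trans psl (sym pd)))
    ... | 1ℙ = inj₂ (evenGap-intro 2+l≤d (trans pl (sym pd)) ,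
                     ≤∧parity≢⇒< d≤2l (parities-differ pd (parity-double l)))
      where
      2+l≤d : 2 + l ≤ d
      2+l≤d = ≤∧parity≢⇒< (¬evenGap⇒> ¬gap-d-l (trans pd (sym pl))) (parities-differ psl pd)
    from : (EvenGap 2 d × d < l) ⊎ (EvenGap (2 + l) d × d < l + l) → InWindow l d × TrivRegular l d
    from (inj₁ (gap , d<l)) =
      (≤-trans (s≤s z≤n) (evenGap⇒≤ gap) , ≤-trans (<⇒≤ d<l) (m≤m+n l l)) ,
      parity≢⇒¬evenGap (parities-differ (sym (evenGap⇒parity gap)) pl) ,
      <⇒¬evenGap (m≤n⇒m≤1+n d<l)
    from (inj₂ (gap , d<2l)) =
      (≤-trans (s≤s z≤n) (evenGap⇒≤ gap) , <⇒≤ d<2l) ,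
      <⇒¬evenGap (<⇒≤ (evenGap⇒≤ gap)) ,
      parity≢⇒¬evenGap (parities-differ psl (trans (sym (evenGap⇒parity gap)) pl))

  window-sgn⇔ : ∀ {l d} → parity l ≡ 1ℙ →
    (InWindow l d × SgnRegular l d) ⇔ ((EvenGap 1 d × d ≤ l) ⊎ (EvenGap (suc l) d × d ≤ l + l))
  window-sgn⇔ {l} {d} pl = mk⇔ to from
    where
    psl : parity (suc l) ≡ 0ℙ
    psl = parity-suc≡ l pl
    to : InWindow l d × SgnRegular l d → (EvenGap 1 d × d ≤ l) ⊎ (EvenGap (suc l) d × d ≤ l + l)
    to ((1≤d , d≤2l) , ¬gap-sd-l , ¬gap-2l-d) with parity d in pd
    ... | 1ℙ = inj₁ (evenGap-intro 1≤d (sym pd) ,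
                     s≤s⁻¹ (≤∧parity≢⇒< d≤sl (parities-differ pd psl)))
      where
      d≤sl : d ≤ suc l
      d≤sl = s≤s⁻¹ (¬evenGap⇒> ¬gap-2l-d (trans pl (sym pd)))
    ... | 0ℙ = inj₂ (evenGap-intro (≤∧parity≢⇒< l≤d (parities-differ pl pd)) (trans psl (sym pd)) ,
                     d≤2l)
      where
      l≤d : l ≤ d
      l≤d = s≤s⁻¹ (¬evenGap⇒> ¬gap-sd-l (trans (parity-suc≡ d pd) (sym pl)))
    from : (EvenGap 1 d × d ≤ l) ⊎ (EvenGap (suc l) d × d ≤ l + l) → InWindow l d × SgnRegular l d
    from (inj₁ (gap , d≤l)) =
      (evenGap⇒≤ gap , ≤-trans d≤l (m≤m+n l l)) ,
      parity≢⇒¬evenGap (parities-differ (parity-suc≡ d (sym (evenGap⇒parity gap))) pl) ,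
      <⇒¬evenGap (s≤s (m≤n⇒m≤1+n d≤l))
    from (inj₂ (gap , d≤2l)) =
      (≤-trans (s≤s z≤n) (evenGap⇒≤ gap) , d≤2l) ,
      <⇒¬evenGap (s≤s (<⇒≤ (evenGap⇒≤ gap))) ,
      parity≢⇒¬evenGap (parities-differ pl (trans (sym (evenGap⇒parity gap)) psl))

module IntegerOffsets where
  open EvenGaps using (EvenGap; evenGap)
  open import Data.Nat as ℕ using (zero; suc; s≤s)
  import Data.Nat.Properties as ℕₚ
  open import Data.Integer using (ℤ; +_; -[1+_]; _+_; _-_; -_; _≤_; +≤+)
  import Data.Integer.Properties as ℤₚ
  open import Data.Integer.Tactic.RingSolver using (solve-∀)
  open import Data.Empty using (⊥-elim)
  open import Data.Product using (_×_; _,_; ∃-syntax)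
  open import Data.Product.Function.NonDependent.Propositional using (_×-⇔_)
  open import Data.Sum using (_⊎_; inj₁; inj₂)
  open import Data.Sum.Function.Propositional using (_⊎-⇔_)
  open import Function.Bundles using (_⇔_; mk⇔; Equivalence)
  import Function.Properties.Equivalence as ⇔
  open import Relation.Nullary using (¬_)
  open import Relation.Binary.PropositionalEquality

  -i+[i+j]≡j : ∀ i j → - i + (i + j) ≡ j
  -i+[i+j]≡j = solve-∀

  +-cancelˡ-≡ : ∀ i {j k} → i + j ≡ i + k → j ≡ k
  +-cancelˡ-≡ i {j} {k} eq =
    trans (sym (-i+[i+j]≡j i j)) (trans (cong (λ x → - i + x) eq) (-i+[i+j]≡j i k))

  +-cancelˡ-≤⇔ : ∀ i j k → (i + j ≤ i + k) ⇔ (j ≤ k)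
  +-cancelˡ-≤⇔ i j k =
    mk⇔ (λ le → subst₂ _≤_ (-i+[i+j]≡j i j) (-i+[i+j]≡j i k) (ℤₚ.+-monoʳ-≤ (- i) le))
        (ℤₚ.+-monoʳ-≤ i)

  ≤pred⇔< : ∀ d b → (+ d ≤ + b - + 1) ⇔ d ℕ.< b
  ≤pred⇔< d zero = mk⇔ (λ ()) (λ ())
  ≤pred⇔< d (suc b) = mk⇔ (λ le → s≤s (ℤₚ.drop‿+≤+ le)) (λ { (s≤s d≤b) → +≤+ d≤b })

  ≤-offset⇔ : ∀ B {hi} b d → hi ≡ B + + b → (B + + d ≤ hi) ⇔ d ℕ.≤ b
  ≤-offset⇔ B b d refl = ⇔.trans (+-cancelˡ-≤⇔ B (+ d) (+ b)) (mk⇔ ℤₚ.drop‿+≤+ +≤+)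

  ≤-offset-1⇔ : ∀ B {hi} b d → hi ≡ (B + + b) - + 1 → (B + + d ≤ hi) ⇔ d ℕ.< b
  ≤-offset-1⇔ B b d refl =
    ⇔.trans (subst (λ x → (B + + d ≤ x) ⇔ (+ d ≤ + b - + 1)) (sym (assoc B (+ b)))
                   (+-cancelˡ-≤⇔ B (+ d) (+ b - + 1)))
            (≤pred⇔< d b)
    where
    assoc : ∀ B X → (B + X) - + 1 ≡ B + (X - + 1)
    assoc = solve-∀

  InAP-offset⇔ : ∀ B a hi d → InAP (B + + a) hi (B + + d) ⇔ (EvenGap a d × B + + d ≤ hi)
  InAP-offset⇔ B a hi d = mk⇔
    (λ (_ , d≤hi , j , eq) →
      evenGap j (ℤₚ.+-injective (+-cancelˡ-≡ B (trans eq (ℤₚ.+-assoc B (+ a) (+ (2 ℕ.* j)))))) , d≤hi)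
    (λ { (evenGap j refl , d≤hi) →
      ℤₚ.+-monoʳ-≤ B (+≤+ (ℕₚ.m≤m+n a (2 ℕ.* j))) , d≤hi , j , sym (ℤₚ.+-assoc B (+ a) (+ (2 ℕ.* j))) })

  InAP-below : ∀ B a hi d → ¬ InAP (B + + a) hi (B - + suc d)
  InAP-below B a hi d (a≤-d , _) with Equivalence.to (+-cancelˡ-≤⇔ B (+ a) (- + suc d)) a≤-d
  ... | ()

  i≡j+[i-j] : ∀ i j → i ≡ j + (i - j)
  i≡j+[i-j] = solve-∀

  offset-or-below : ∀ B m → (∃[ d ] m ≡ B + + d) ⊎ (∃[ d ] m ≡ B - + suc d)
  offset-or-below B m with m - B | i≡j+[i-j] m B
  ... | + d      | m≡B+d   = inj₁ (d , m≡B+d)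
  ... | -[1+ d ] | m≡B-1-d = inj₂ (d , m≡B-1-d)

  agree-by-offsets : ∀ (B : ℤ) {P Q : ℤ → Set} →
    (∀ d → P (B + + d) ⇔ Q (B + + d)) → (∀ d → ¬ P (B - + suc d)) → (∀ d → ¬ Q (B - + suc d)) →
    ∀ m → P m ⇔ Q m
  agree-by-offsets B at-offset ¬P-below ¬Q-below m with offset-or-below B m
  ... | inj₁ (d , refl) = at-offset d
  ... | inj₂ (d , refl) = mk⇔ (λ p → ⊥-elim (¬P-below d p)) (λ q → ⊥-elim (¬Q-below d q))

  twoAPs-offset⇔ : ∀ B {lo₁ hi₁ lo₂ hi₂ a₁ a₂ d} {U₁ U₂ : Set} →
    lo₁ ≡ B + + a₁ → lo₂ ≡ B + + a₂ → (B + + d ≤ hi₁) ⇔ U₁ → (B + + d ≤ hi₂) ⇔ U₂ →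
    (InAP lo₁ hi₁ (B + + d) ⊎ InAP lo₂ hi₂ (B + + d)) ⇔ ((EvenGap a₁ d × U₁) ⊎ (EvenGap a₂ d × U₂))
  twoAPs-offset⇔ B {_} {hi₁} {_} {hi₂} {a₁} {a₂} {d} refl refl bound₁ bound₂ =
    ⇔.trans (InAP-offset⇔ B a₁ hi₁ d) (⇔.refl ×-⇔ bound₁) ⊎-⇔
    ⇔.trans (InAP-offset⇔ B a₂ hi₂ d) (⇔.refl ×-⇔ bound₂)

  twoAPs-below : ∀ B {lo₁ hi₁ lo₂ hi₂ a₁ a₂} d → lo₁ ≡ B + + a₁ → lo₂ ≡ B + + a₂ →
    ¬ (InAP lo₁ hi₁ (B - + suc d) ⊎ InAP lo₂ hi₂ (B - + suc d))
  twoAPs-below B {hi₁ = hi₁} {a₁ = a₁} d refl _ (inj₁ ap) = InAP-below B a₁ hi₁ d ap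
  twoAPs-below B {hi₂ = hi₂} {a₂ = a₂} d _ refl (inj₂ ap) = InAP-below B a₂ hi₂ d ap

module CriticalPoints where
  open EvenGaps
  open IntegerOffsets
  open import Data.Nat as ℕ using (ℕ; zero; suc; parity)
  import Data.Nat.Properties as ℕₚ
  open import Data.Integer using (ℤ; +_; _+_; _-_; _*_; -_; 1ℤ; _≤_)
  import Data.Integer.Properties as ℤₚ
  open import Data.Integer.Tactic.RingSolver using (solve-∀)
  open import Data.List using (map; upTo)
  open import Data.List.Relation.Unary.All as All using (_∷_; [])
  import Data.List.Relation.Unary.All.Properties as Allₚ
  open import Data.List.Membership.Propositional using (_∈_)
  open import Data.List.Membership.Propositional.Properties using (∈-upTo⁺; ∈-upTo⁻; ∈-map⁺)
  open import Data.Parity.Base as ℙ using (0ℙ; 1ℙ)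
  import Data.Parity.Properties as ℙₚ
  open import Data.Product using (_×_; _,_; proj₁)
  open import Data.Product.Function.NonDependent.Propositional using (_×-⇔_)
  open import Data.Sum using (_⊎_)
  open import Function.Bundles using (_⇔_; mk⇔; Equivalence)
  import Function.Properties.Equivalence as ⇔
  open import Function.Related.TypeIsomorphisms using (¬-cong-⇔)
  open import Relation.Nullary using (¬_)
  open import Relation.Binary.PropositionalEquality

  ΓHalfPole⇔EvenGap : ∀ a b → ΓHalfPole (+ a - + b) ⇔ EvenGap a b
  ΓHalfPole⇔EvenGap a b = mk⇔ to from
    where
    to : ΓHalfPole (+ a - + b) → EvenGap a b
    to (j , a-b≡-2j) = evenGap j (ℤₚ.+-injective (begin
      + b                   ≡⟨ cancel (+ a) (+ b) ⟩
      + a - (+ a - + b)     ≡⟨ cong (λ x → + a - x) a-b≡-2j ⟩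
      + a - - + (2 ℕ.* j)   ≡⟨ neg-neg (+ a) (+ (2 ℕ.* j)) ⟩
      + a + + (2 ℕ.* j)     ∎))
      where
      open ≡-Reasoning
      cancel : ∀ A B → B ≡ A - (A - B)
      cancel = solve-∀
      neg-neg : ∀ A J → A - - J ≡ A + J
      neg-neg = solve-∀
    from : EvenGap a b → ΓHalfPole (+ a - + b)
    from (evenGap j refl) = j , shift (+ a) (+ (2 ℕ.* j))
      where
      shift : ∀ A J → A - (A + J) ≡ - J
      shift = solve-∀

  ΓHalfPole-at : ∀ {y} a b → y ≡ + a - + b → ΓHalfPole y ⇔ EvenGap a b
  ΓHalfPole-at a b refl = ΓHalfPole⇔EvenGap a b

  sgnPole⇔ : ∀ a b → poleAt sgn (+ a - + b) ⇔ EvenGap (suc a) b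
  sgnPole⇔ a b = ΓHalfPole-at (suc a) b (shift (+ a) (+ b))
    where
    shift : ∀ A B → (A - B) + 1ℤ ≡ (+ 1 + A) - B
    shift = solve-∀

  indPole⇔ : ∀ n a b → poleAt (ind (2 ℕ.* n)) (+ a - + b) ⇔ a ℕ.+ n ℕ.≤ b
  indPole⇔ n a b =
    ⇔.trans (ΓHalfPole-at _ _ point) (evenGap-double⇔ (a ℕ.+ n) b)
    where
    point : (+ a - + b) + (+ a - + b) + + (2 ℕ.* n) ≡ + ((a ℕ.+ n) ℕ.+ (a ℕ.+ n)) - + (b ℕ.+ b)
    point = trans (cong (λ x → (+ a - + b) + (+ a - + b) + x) (ℤₚ.pos-* 2 n))
                  (rearrange (+ a) (+ b) (+ n))
      where
      rearrange : ∀ A B N → (A - B) + (A - B) + + 2 * N ≡ ((A + N) + (A + N)) - (B + B)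
      rearrange = solve-∀

  indPole-scaled⇔ : ∀ l c a b → poleAt (ind (2 ℕ.* l ℕ.* c)) (+ a - + b) ⇔ a ℕ.+ l ℕ.* c ℕ.≤ b
  indPole-scaled⇔ l c a b =
    subst (λ L → poleAt (ind L) (+ a - + b) ⇔ (a ℕ.+ l ℕ.* c ℕ.≤ b)) (sym (ℕₚ.*-assoc 2 l c))
          (indPole⇔ (l ℕ.* c) a b)

  indPart : ℕ → ℕ → Param
  indPart r l = map (λ i → ind (2 ℕ.* l ℕ.* (r ℕ.∸ i))) (upTo r)

  -- Γ(s + lc) with c ≥ 1 has a pole only where Γ(s + l) has one, so the constituent c = 1 decides.
  regular-indPart⇔ : ∀ r l a b → Regular (indPart (suc r) l) (+ a - + b) ⇔ (¬ a ℕ.+ l ℕ.≤ b)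
  regular-indPart⇔ r l a b = mk⇔ to from
    where
    to : Regular (indPart (suc r) l) (+ a - + b) → ¬ a ℕ.+ l ℕ.≤ b
    to R a+l≤b = All.lookup R outermost (Equivalence.from (indPole-scaled⇔ l (suc r ℕ.∸ r) a b) a+l·1≤b)
      where
      outermost : ind (2 ℕ.* l ℕ.* (suc r ℕ.∸ r)) ∈ indPart (suc r) l
      outermost = ∈-map⁺ _ (∈-upTo⁺ (ℕₚ.n<1+n r))
      a+l·1≤b : a ℕ.+ l ℕ.* (suc r ℕ.∸ r) ℕ.≤ b
      a+l·1≤b rewrite ℕₚ.m+n∸n≡m 1 r | ℕₚ.*-identityʳ l = a+l≤b
    from : ¬ a ℕ.+ l ℕ.≤ b → Regular (indPart (suc r) l) (+ a - + b)
    from a+l≰b = Allₚ.map⁺ (All.tabulate λ i∈ pole → a+l≰b (ℕₚ.≤-trans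
      (ℕₚ.+-monoʳ-≤ a (l≤l*c (ℕₚ.m<n⇒0<n∸m (∈-upTo⁻ i∈))))
      (Equivalence.to (indPole-scaled⇔ l _ a b) pole)))
      where
      l≤l*c : ∀ {c} → 1 ℕ.≤ c → l ℕ.≤ l ℕ.* c
      l≤l*c {c} 1≤c = subst (ℕ._≤ l ℕ.* c) (ℕₚ.*-identityʳ l) (ℕₚ.*-monoʳ-≤ l 1≤c)

  regular-symEven⇔ : ∀ r l {s} a b → s ≡ + a - + b →
    Regular (symEven (suc r) l) s ⇔ (¬ a ℕ.+ l ℕ.≤ b × ¬ poleAt (sgnPow (l ℕ.* suc r)) (+ a - + b))
  regular-symEven⇔ r l a b refl = mk⇔
    (λ R → let R-ind , R-mid = Allₚ.++⁻ (indPart (suc r) l) R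
           in Equivalence.to (regular-indPart⇔ r l a b) R-ind , Allₚ.singleton⁻ R-mid)
    (λ (a+l≰b , ¬mid) → Allₚ.++⁺ (Equivalence.from (regular-indPart⇔ r l a b) a+l≰b) (¬mid ∷ []))

  sgnPow-even : ∀ n → parity n ≡ 0ℙ → sgnPow n ≡ triv
  sgnPow-even zero _ = refl
  sgnPow-even (suc zero) ()
  sgnPow-even (suc (suc n)) pn = sgnPow-even n pn

  sgnPow-odd : ∀ n → parity n ≡ 1ℙ → sgnPow n ≡ sgn
  sgnPow-odd zero ()
  sgnPow-odd (suc zero) _ = refl
  sgnPow-odd (suc (suc n)) pn = sgnPow-odd n pn

  trivRegular⇔ : ∀ l d → (¬ poleAt triv (+ d - + l) × ¬ poleAt triv (+ suc l - + d)) ⇔ TrivRegular l d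
  trivRegular⇔ l d = ¬-cong-⇔ (ΓHalfPole⇔EvenGap d l) ×-⇔ ¬-cong-⇔ (ΓHalfPole⇔EvenGap (suc l) d)

  sgnRegular⇔ : ∀ l d → (¬ poleAt sgn (+ d - + l) × ¬ poleAt sgn (+ suc l - + d)) ⇔ SgnRegular l d
  sgnRegular⇔ l d = ¬-cong-⇔ (sgnPole⇔ d l) ×-⇔ ¬-cong-⇔ (sgnPole⇔ (suc l) d)

  critical-offset⇔ : ∀ r l d {c} → sgnPow (l ℕ.* suc r) ≡ c →
    CriticalSym2r (suc r) (suc l) (+ r * + l + + d) ⇔
    (InWindow l d × ¬ poleAt c (+ d - + l) × ¬ poleAt c (+ suc l - + d))
  critical-offset⇔ r l d refl = mk⇔
    (λ (R , R′) →
      let d+l≰l , ¬pole = Equivalence.to at-s R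
          1+l+l≰d , ¬pole′ = Equivalence.to at-1-s R′
      in (Equivalence.to (m+n≰n⇔0<m d l) d+l≰l , ℕₚ.≮⇒≥ 1+l+l≰d) , ¬pole , ¬pole′)
    (λ ((0<d , d≤2l) , ¬pole , ¬pole′) →
      Equivalence.from at-s (Equivalence.from (m+n≰n⇔0<m d l) 0<d , ¬pole) ,
      Equivalence.from at-1-s (ℕₚ.≤⇒≯ d≤2l , ¬pole′))
    where
    s : ℤ
    s = (+ r * + l + + d) - + (suc r ℕ.* l)
    s≡d-l : s ≡ + d - + l
    s≡d-l = trans (cong (λ x → (+ r * + l + + d) - (+ l + x)) (ℤₚ.pos-* r l)) (shift (+ r) (+ l) (+ d))
      where
      shift : ∀ R L D → (R * L + D) - (L + R * L) ≡ D - L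
      shift = solve-∀
    1-s≡1+l-d : 1ℤ - s ≡ + suc l - + d
    1-s≡1+l-d = trans (cong (λ x → 1ℤ - x) s≡d-l) (reflect (+ d) (+ l))
      where
      reflect : ∀ D L → 1ℤ - (D - L) ≡ (+ 1 + L) - D
      reflect = solve-∀
    at-s : Regular (symEven (suc r) l) s ⇔
           (¬ d ℕ.+ l ℕ.≤ l × ¬ poleAt (sgnPow (l ℕ.* suc r)) (+ d - + l))
    at-s = regular-symEven⇔ r l d l s≡d-l
    at-1-s : Regular (symEven (suc r) l) (1ℤ - s) ⇔
             (¬ suc l ℕ.+ l ℕ.≤ d × ¬ poleAt (sgnPow (l ℕ.* suc r)) (+ suc l - + d))
    at-1-s = regular-symEven⇔ r l (suc l) d 1-s≡1+l-d

  critical-below : ∀ r l d → ¬ CriticalSym2r (suc r) (suc l) (+ r * + l - + suc d)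
  critical-below r l d (R , _) =
    proj₁ (Equivalence.to (regular-symEven⇔ r l 0 (l ℕ.+ suc d) s≡-l-d) R) (ℕₚ.m≤m+n l (suc d))
    where
    s≡-l-d : (+ r * + l - + suc d) - + (suc r ℕ.* l) ≡ + 0 - + (l ℕ.+ suc d)
    s≡-l-d = trans (cong (λ x → (+ r * + l - + suc d) - (+ l + x)) (ℤₚ.pos-* r l))
                   (shift (+ r) (+ l) (+ suc d))
      where
      shift : ∀ R L D → (R * L - D) - (L + R * L) ≡ + 0 - (L + D)
      shift = solve-∀

  upper-start : ∀ R L C → (+ 1 + R) * L + C ≡ R * L + (C + L)
  upper-start = solve-∀

  lower-end : ∀ R L → (+ 1 + R) * L ≡ R * L + L
  lower-end = solve-∀

  upper-end : ∀ R L → (+ 1 + R + + 1) * L ≡ R * L + (L + L)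
  upper-end = solve-∀

  critical⇔twoAPs : ∀ r l {c a₁ a₂} {Reg U₁ U₂ : ℕ → Set} {lo₂ hi₁ hi₂} →
    sgnPow (l ℕ.* suc r) ≡ c →
    (∀ d → (¬ poleAt c (+ d - + l) × ¬ poleAt c (+ suc l - + d)) ⇔ Reg d) →
    (∀ d → (InWindow l d × Reg d) ⇔ ((EvenGap a₁ d × U₁ d) ⊎ (EvenGap a₂ d × U₂ d))) →
    lo₂ ≡ + r * + l + + a₂ →
    (∀ d → (+ r * + l + + d ≤ hi₁) ⇔ U₁ d) → (∀ d → (+ r * + l + + d ≤ hi₂) ⇔ U₂ d) →
    ∀ m → CriticalSym2r (suc r) (suc l) m ⇔ (InAP (+ r * + l + + a₁) hi₁ m ⊎ InAP lo₂ hi₂ m)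
  critical⇔twoAPs r l {a₁ = a₁} {lo₂ = lo₂} {hi₁} {hi₂} middle reg window lo₂≡ bound₁ bound₂ =
    agree-by-offsets B at-offset (critical-below r l) (λ d → twoAPs-below B d refl lo₂≡)
    where
    B : ℤ
    B = + r * + l
    at-offset : ∀ d → CriticalSym2r (suc r) (suc l) (B + + d) ⇔
                      (InAP (B + + a₁) hi₁ (B + + d) ⊎ InAP lo₂ hi₂ (B + + d))
    at-offset d = ⇔.trans (critical-offset⇔ r l d middle) (⇔.trans (⇔.refl ×-⇔ reg d)
      (⇔.trans (window d) (⇔.sym (twoAPs-offset⇔ B refl lo₂≡ (bound₁ d) (bound₂ d)))))

  -- The endpoints of the theorem for k = suc l and r replaced by suc r, with + suc x - + 1 computed to + x.
  critical-sgn⇔ : ∀ r l → parity l ≡ 1ℙ → parity (suc r) ≡ 1ℙ → ∀ m →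
    CriticalSym2r (suc r) (suc l) m ⇔
    (InAP (+ r * + l + + 1) (+ suc r * + l) m ⊎ InAP (+ suc r * + l + + 1) ((+ suc r + + 1) * + l) m)
  critical-sgn⇔ r l pl psr = critical⇔twoAPs r l
    (sgnPow-odd (l ℕ.* suc r) (trans (ℙₚ.*-homo-* l (suc r)) (cong₂ ℙ._*_ pl psr)))
    (sgnRegular⇔ l) (λ _ → window-sgn⇔ pl) (upper-start (+ r) (+ l) (+ 1))
    (λ d → ≤-offset⇔ (+ r * + l) l d (lower-end (+ r) (+ l)))
    (λ d → ≤-offset⇔ (+ r * + l) (l ℕ.+ l) d (upper-end (+ r) (+ l)))

  critical-triv-even⇔ : ∀ r l → parity l ≡ 0ℙ → ∀ m →
    CriticalSym2r (suc r) (suc l) m ⇔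
    (InAP (+ r * + l + + 1) (+ suc r * + l - + 1) m ⊎ InAP (+ suc r * + l + + 2) ((+ suc r + + 1) * + l) m)
  critical-triv-even⇔ r l pl = critical⇔twoAPs r l
    (sgnPow-even (l ℕ.* suc r) (trans (ℙₚ.*-homo-* l (suc r)) (cong (ℙ._* parity (suc r)) pl)))
    (trivRegular⇔ l) (λ _ → window-triv-even⇔ pl) (upper-start (+ r) (+ l) (+ 2))
    (λ d → ≤-offset-1⇔ (+ r * + l) l d (cong (_- + 1) (lower-end (+ r) (+ l))))
    (λ d → ≤-offset⇔ (+ r * + l) (l ℕ.+ l) d (upper-end (+ r) (+ l)))

  critical-triv-odd⇔ : ∀ r l → parity l ≡ 1ℙ → parity (suc r) ≡ 0ℙ → ∀ m →
    CriticalSym2r (suc r) (suc l) m ⇔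
    (InAP (+ r * + l + + 2) (+ suc r * + l - + 1) m ⊎ InAP (+ suc r * + l + + 2) ((+ suc r + + 1) * + l - + 1) m)
  critical-triv-odd⇔ r l pl psr = critical⇔twoAPs r l
    (sgnPow-even (l ℕ.* suc r) (trans (ℙₚ.*-homo-* l (suc r)) (cong₂ ℙ._*_ pl psr)))
    (trivRegular⇔ l) (λ _ → window-triv-odd⇔ pl) (upper-start (+ r) (+ l) (+ 2))
    (λ d → ≤-offset-1⇔ (+ r * + l) l d (cong (_- + 1) (lower-end (+ r) (+ l))))
    (λ d → ≤-offset-1⇔ (+ r * + l) (l ℕ.+ l) d (cong (_- + 1) (upper-end (+ r) (+ l))))

open import Data.Nat using (ℕ; zero; suc; _≤_)
open import Data.Nat.Divisibility using (_∣_)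
open import Data.Integer using (ℤ; +_; _+_; _-_; _*_)
open import Data.Product using (_×_; _,_)
open import Data.Sum using (_⊎_)
open import Function.Bundles using (_⇔_)
open import Relation.Nullary using (¬_)
open EvenGaps using (parity-pred≡; ∣⇒parity≡0ℙ; ∤⇒parity≡1ℙ)
open CriticalPoints using (critical-sgn⇔; critical-triv-even⇔; critical-triv-odd⇔)

lemma3p3p5 : (k r : ℕ) → 1 ≤ k → 1 ≤ r →
    (¬ (2 ∣ r) → 2 ∣ k → (m : ℤ) → CriticalSym2r r k m ⇔
      (InAP ((+ r - + 1) * (+ k - + 1) + + 1) (+ r * (+ k - + 1)) m
       ⊎ InAP (+ r * (+ k - + 1) + + 1) ((+ r + + 1) * (+ k - + 1)) m))
    × (¬ (2 ∣ r) → ¬ (2 ∣ k) → (m : ℤ) → CriticalSym2r r k m ⇔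
      (InAP ((+ r - + 1) * (+ k - + 1) + + 1) (+ r * (+ k - + 1) - + 1) m
       ⊎ InAP (+ r * (+ k - + 1) + + 2) ((+ r + + 1) * (+ k - + 1)) m))
    × (2 ∣ r → 2 ∣ k → (m : ℤ) → CriticalSym2r r k m ⇔
      (InAP ((+ r - + 1) * (+ k - + 1) + + 2) (+ r * (+ k - + 1) - + 1) m
       ⊎ InAP (+ r * (+ k - + 1) + + 2) ((+ r + + 1) * (+ k - + 1) - + 1) m))
    × (2 ∣ r → ¬ (2 ∣ k) → (m : ℤ) → CriticalSym2r r k m ⇔
      (InAP ((+ r - + 1) * (+ k - + 1) + + 1) (+ r * (+ k - + 1) - + 1) m
       ⊎ InAP (+ r * (+ k - + 1) + + 2) ((+ r + + 1) * (+ k - + 1)) m))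
lemma3p3p5 zero r () _
lemma3p3p5 (suc l) zero _ ()
lemma3p3p5 (suc l) (suc r) _ _ =
  (λ 2∤r 2∣k → critical-sgn⇔ r l (parity-pred≡ l (∣⇒parity≡0ℙ 2∣k)) (∤⇒parity≡1ℙ 2∤r)) ,
  (λ _ 2∤k → critical-triv-even⇔ r l (parity-pred≡ l (∤⇒parity≡1ℙ 2∤k))) ,
  (λ 2∣r 2∣k → critical-triv-odd⇔ r l (parity-pred≡ l (∣⇒parity≡0ℙ 2∣k)) (∣⇒parity≡0ℙ 2∣r)) ,
  (λ _ 2∤k → critical-triv-even⇔ r l (parity-pred≡ l (∤⇒parity≡1ℙ 2∤k)))
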